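{- Let $2<p<q$ be primes, let $m=\varphi(pq)=(p-1)(q-1)$, let $\boldsymbol{d}_0=1(-1)0\cdots0\in\mathcal{A}^p$ with $\mathcal{A}=\{ -1,0,1\}$, and let $\boldsymbol{d}_i=\sigma^{iq}(\boldsymbol{d}_0)$ for $i\ge1$. Then $$\boldsymbol{d}_0^{(m+1)/p}=\boldsymbol{d}_0^{q/p}\cdot\boldsymbol{d}_1^{q/p}\cdots\boldsymbol{d}_{p-3}^{q/p}\cdot\boldsymbol{d}_{p-2}^{(q-p+2)/p}.$$
   Context: Words are finite sequences over $\mathcal{A}$; $\cdot$ denotes concatenation and $\boldsymbol{v}^s$ the $s$-fold concatenation (empty for $s=0$). For $\boldsymbol{v}\in\mathcal{A}^p$ and integer $k\ge0$, the fractional power $\boldsymbol{v}^{k/p}\in\mathcal{A}^k$ is the prefix of $\boldsymbol{v}$ of length $k$ if $k<p$, and $\boldsymbol{v}^{\lfloor k/p\rfloor}\cdot\boldsymbol{v}^{(k\bmod p)/p}$ if $k\ge p$. The left circular permutation is $\sigma(v_0v_1\cdots v_{p-1})=v_1\cdots v_{p-1}v_0$. -}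

module Defs where

open import Data.Nat using (ℕ; zero; suc; _+_; _*_; _∸_; _<?_)
open import Data.Nat.DivMod using (_/_; _%_)
open import Data.List using (List; []; _∷_; _++_; take; length; replicate; concat; map; upTo)
open import Relation.Nullary using (yes; no)

data 𝒜 : Set where
  neg1 zero0 pos1 : 𝒜

Word : Set
Word = List 𝒜

pow : Word → ℕ → Word
pow v zero    = []
pow v (suc s) = v ++ pow v s

-- fractional power v^{k/p} where p = length v (p ≥ 1);
-- for the empty word (p = 0, outside the paper's definition) we return [].
fracPow : Word → ℕ → Word
fracPow []       k = []
fracPow (x ∷ xs) k with k <? length (x ∷ xs)
... | yes _ = take k (x ∷ xs)
... | no  _ = pow (x ∷ xs) (k / length (x ∷ xs)) ++ take (k % length (x ∷ xs)) (x ∷ xs)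

σ : Word → Word
σ []       = []
σ (x ∷ xs) = xs ++ (x ∷ [])

σ^ : ℕ → Word → Word
σ^ zero    w = w
σ^ (suc n) w = σ (σ^ n w)

d₀ : ℕ → Word
d₀ p = pos1 ∷ neg1 ∷ replicate (p ∸ 2) zero0

d : ℕ → ℕ → ℕ → Word
d p q i = σ^ (i * q) (d₀ p)

-- v^{k/p} is the length-k prefix of the periodic word v v v ⋯, and that word
-- read from position m is the periodic word of σ^m(v). Since
-- (p − 1)(q − 1) + 1 = (p − 2) q + (q − p + 2), cutting the prefix of length
-- m + 1 into p − 2 blocks of length q and one of length q − p + 2 gives the
-- right-hand side, the i-th block starting at position iq.
module Submission where

open import Defs
open import Data.Nat using (ℕ; zero; suc; _+_; _*_; _∸_; _≤_; _<_; _<?_; s≤s; z≤n)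
open import Data.Nat.Primality using (Prime)
open import Data.Nat.DivMod using (_/_; _%_; m≡m%n+[m/n]*n; m%n<n)
open import Data.Nat.Properties using (+-comm; +-assoc; m+n∸m≡n; ≤-refl; <⇒≤; m≤n⇒∃[o]m+o≡n)
open import Data.Nat.Solver using (module +-*-Solver)
open import Data.List using ([]; _∷_; _++_; [_]; take; length; concat; map; upTo)
open import Data.List.Properties
  using (++-assoc; ++-identityʳ; take-all; map-cong; map-++; concat-++; upTo-∷ʳ)
open import Relation.Binary.PropositionalEquality
  using (_≡_; refl; sym; trans; cong; cong₂; module ≡-Reasoning)
open import Data.Product using (_,_)
open import Relation.Nullary using (yes; no)

open ≡-Reasoning

takeCyclic : Word → ℕ → Word
takeCyclic v        zero    = []
takeCyclic []       (suc k) = []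
takeCyclic (x ∷ xs) (suc k) = x ∷ takeCyclic (σ (x ∷ xs)) k

σ^-σ : ∀ n v → σ^ n (σ v) ≡ σ (σ^ n v)
σ^-σ zero    v = refl
σ^-σ (suc n) v = cong σ (σ^-σ n v)

σ^-[] : ∀ n → σ^ n [] ≡ []
σ^-[] zero    = refl
σ^-[] (suc n) = cong σ (σ^-[] n)

σ^-length-++ : ∀ (ys zs : Word) → σ^ (length ys) (ys ++ zs) ≡ zs ++ ys
σ^-length-++ []       zs = sym (++-identityʳ zs)
σ^-length-++ (y ∷ ys) zs = begin
  σ (σ^ (length ys) (y ∷ ys ++ zs))     ≡⟨ sym (σ^-σ (length ys) (y ∷ ys ++ zs)) ⟩
  σ^ (length ys) ((ys ++ zs) ++ [ y ])  ≡⟨ cong (σ^ (length ys)) (++-assoc ys zs [ y ]) ⟩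
  σ^ (length ys) (ys ++ zs ++ [ y ])    ≡⟨ σ^-length-++ ys (zs ++ [ y ]) ⟩
  (zs ++ [ y ]) ++ ys                   ≡⟨ ++-assoc zs [ y ] ys ⟩
  zs ++ y ∷ ys                          ∎

σ^-length : ∀ v → σ^ (length v) v ≡ v
σ^-length v = trans (cong (σ^ (length v)) (sym (++-identityʳ v))) (σ^-length-++ v [])

takeCyclic-[] : ∀ k → takeCyclic [] k ≡ []
takeCyclic-[] zero    = refl
takeCyclic-[] (suc k) = refl

takeCyclic-+ : ∀ m n v → takeCyclic v (m + n) ≡ takeCyclic v m ++ takeCyclic (σ^ m v) n
takeCyclic-+ zero    n v        = refl
takeCyclic-+ (suc m) n []       = sym (trans (cong (λ w → takeCyclic (σ w) n) (σ^-[] m)) (takeCyclic-[] n))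
takeCyclic-+ (suc m) n (x ∷ xs) = cong (x ∷_) (begin
  takeCyclic (σ v) (m + n)                          ≡⟨ takeCyclic-+ m n (σ v) ⟩
  takeCyclic (σ v) m ++ takeCyclic (σ^ m (σ v)) n   ≡⟨ cong (λ w → takeCyclic (σ v) m ++ takeCyclic w n) (σ^-σ m v) ⟩
  takeCyclic (σ v) m ++ takeCyclic (σ (σ^ m v)) n   ∎)
  where v = x ∷ xs

takeCyclic-++ : ∀ k (ys zs : Word) → k ≤ length ys → takeCyclic (ys ++ zs) k ≡ take k ys
takeCyclic-++ zero    ys       zs _       = refl
takeCyclic-++ (suc k) (y ∷ ys) zs (s≤s k≤) = cong (y ∷_) (begin
  takeCyclic ((ys ++ zs) ++ [ y ]) k  ≡⟨ cong (λ w → takeCyclic w k) (++-assoc ys zs [ y ]) ⟩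
  takeCyclic (ys ++ zs ++ [ y ]) k    ≡⟨ takeCyclic-++ k ys (zs ++ [ y ]) k≤ ⟩
  take k ys                           ∎)

takeCyclic-≤ : ∀ k v → k ≤ length v → takeCyclic v k ≡ take k v
takeCyclic-≤ k v k≤ = trans (cong (λ w → takeCyclic w k) (sym (++-identityʳ v))) (takeCyclic-++ k v [] k≤)

takeCyclic-length : ∀ v → takeCyclic v (length v) ≡ v
takeCyclic-length v = trans (takeCyclic-≤ (length v) v ≤-refl) (take-all (length v) v ≤-refl)

takeCyclic-pow : ∀ n r v → takeCyclic v (n * length v + r) ≡ pow v n ++ takeCyclic v r
takeCyclic-pow zero    r v = refl
takeCyclic-pow (suc n) r v = begin
  takeCyclic v ((length v + n * length v) + r)
    ≡⟨ cong (takeCyclic v) (+-assoc (length v) (n * length v) r) ⟩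
  takeCyclic v (length v + (n * length v + r))
    ≡⟨ takeCyclic-+ (length v) (n * length v + r) v ⟩
  takeCyclic v (length v) ++ takeCyclic (σ^ (length v) v) (n * length v + r)
    ≡⟨ cong₂ _++_ (takeCyclic-length v) (cong (λ w → takeCyclic w (n * length v + r)) (σ^-length v)) ⟩
  v ++ takeCyclic v (n * length v + r)
    ≡⟨ cong (v ++_) (takeCyclic-pow n r v) ⟩
  v ++ (pow v n ++ takeCyclic v r)
    ≡⟨ sym (++-assoc v (pow v n) (takeCyclic v r)) ⟩
  (v ++ pow v n) ++ takeCyclic v r
    ∎

fracPow≡takeCyclic : ∀ v k → fracPow v k ≡ takeCyclic v k
fracPow≡takeCyclic []       k = sym (takeCyclic-[] k)
fracPow≡takeCyclic (x ∷ xs) k with k <? length (x ∷ xs)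
... | yes k<p = sym (takeCyclic-≤ k (x ∷ xs) (<⇒≤ k<p))
... | no  _   = sym (begin
  takeCyclic v k                         ≡⟨ cong (takeCyclic v) (trans (m≡m%n+[m/n]*n k p) (+-comm (k % p) _)) ⟩
  takeCyclic v (k / p * p + k % p)       ≡⟨ takeCyclic-pow (k / p) (k % p) v ⟩
  pow v (k / p) ++ takeCyclic v (k % p)  ≡⟨ cong (pow v (k / p) ++_) (takeCyclic-≤ (k % p) v (<⇒≤ (m%n<n k p))) ⟩
  pow v (k / p) ++ take (k % p) v        ∎)
  where
  v = x ∷ xs
  p = length v

takeCyclic-* : ∀ n q v → takeCyclic v (n * q) ≡ concat (map (λ i → takeCyclic (σ^ (i * q) v) q) (upTo n))
takeCyclic-* zero    q v = refl
takeCyclic-* (suc n) q v = begin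
  takeCyclic v (q + n * q)                    ≡⟨ cong (takeCyclic v) (+-comm q (n * q)) ⟩
  takeCyclic v (n * q + q)                    ≡⟨ takeCyclic-+ (n * q) q v ⟩
  takeCyclic v (n * q) ++ block n             ≡⟨ cong₂ _++_ (takeCyclic-* n q v) (sym (++-identityʳ (block n))) ⟩
  concat (map block (upTo n)) ++ concat [ block n ]
                                              ≡⟨ concat-++ (map block (upTo n)) [ block n ] ⟩
  concat (map block (upTo n) ++ [ block n ])  ≡⟨ cong concat (sym (map-++ block (upTo n) [ n ])) ⟩
  concat (map block (upTo n ++ [ n ]))        ≡⟨ cong (λ is → concat (map block is)) (upTo-∷ʳ n) ⟩
  concat (map block (upTo (suc n)))           ∎
  where
  block : ℕ → Word
  block i = takeCyclic (σ^ (i * q) v) q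

[m∸1]*[n∸1]+1≡[m∸2]*n+[n∸m+2] : ∀ {m n} → 2 ≤ m → m ≤ n →
  (m ∸ 1) * (n ∸ 1) + 1 ≡ (m ∸ 2) * n + (n ∸ m + 2)
[m∸1]*[n∸1]+1≡[m∸2]*n+[n∸m+2] {suc (suc a)} (s≤s (s≤s z≤n)) m≤n with m≤n⇒∃[o]m+o≡n m≤n
... | c , refl = begin
  suc a * suc (a + c) + 1        ≡⟨ +-*-Solver.solve 2 (λ a c → (con 1 :+ a) :* (con 1 :+ (a :+ c)) :+ con 1
                                      := a :* (con 2 :+ (a :+ c)) :+ (c :+ con 2)) refl a c ⟩
  a * suc (suc (a + c)) + (c + 2) ≡⟨ cong (λ t → a * suc (suc (a + c)) + (t + 2)) (sym (m+n∸m≡n a c)) ⟩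
  a * suc (suc (a + c)) + (a + c ∸ a + 2) ∎
  where open +-*-Solver using (con; _:+_; _:*_; _:=_)

proposition1 : (p q : ℕ) → Prime p → Prime q → 2 < p → p < q →
    fracPow (d₀ p) ((p ∸ 1) * (q ∸ 1) + 1)
      ≡ concat (map (λ i → fracPow (d p q i) q) (upTo (p ∸ 2)))
        ++ fracPow (d p q (p ∸ 2)) (q ∸ p + 2)
proposition1 p q _ _ 2<p p<q = begin
  fracPow v ((p ∸ 1) * (q ∸ 1) + 1)
    ≡⟨ fracPow≡takeCyclic v _ ⟩
  takeCyclic v ((p ∸ 1) * (q ∸ 1) + 1)
    ≡⟨ cong (takeCyclic v) ([m∸1]*[n∸1]+1≡[m∸2]*n+[n∸m+2] (<⇒≤ 2<p) (<⇒≤ p<q)) ⟩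
  takeCyclic v ((p ∸ 2) * q + r)
    ≡⟨ takeCyclic-+ ((p ∸ 2) * q) r v ⟩
  takeCyclic v ((p ∸ 2) * q) ++ takeCyclic (d p q (p ∸ 2)) r
    ≡⟨ cong₂ _++_ (takeCyclic-* (p ∸ 2) q v) (sym (fracPow≡takeCyclic _ r)) ⟩
  concat (map (λ i → takeCyclic (d p q i) q) (upTo (p ∸ 2))) ++ fracPow (d p q (p ∸ 2)) r
    ≡⟨ cong (λ ws → concat ws ++ fracPow (d p q (p ∸ 2)) r)
            (map-cong (λ i → sym (fracPow≡takeCyclic (d p q i) q)) (upTo (p ∸ 2))) ⟩
  concat (map (λ i → fracPow (d p q i) q) (upTo (p ∸ 2))) ++ fracPow (d p q (p ∸ 2)) r
    ∎
  where
  v = d₀ p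
  r = q ∸ p + 2
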